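{- In the forward-march model described in the context, for every permutation $\pi$ that is not the identity and every forward-march prefix reversal $\beta$ applicable to $\pi$, $b_{FM}(\pi)-b_{FM}(\pi\cdot\beta)\le 2$.
   Context: A permutation is $\pi=[\pi_0,\pi_1,\ldots,\pi_n,\pi_{n+1}]$ with $\pi_0=0$, $\pi_{n+1}=n+1$ and $(\pi_1,\ldots,\pi_n)$ a permutation of $\{1,\ldots,n\}$; the identity has $\pi_i=i$ for all $i$. Let $s(\pi)$ be the largest $s\in\{0,\ldots,n+1\}$ with $\pi_k=k$ for all $0\le k\le s$. If $\pi$ is not the identity and $s=s(\pi)$, a forward-march prefix reversal, for some $s+3\le j\le n+1$, transforms $\pi$ into $[\pi_0,\ldots,\pi_s,\pi_{j-1},\ldots,\pi_{s+1},\pi_j,\ldots,\pi_{n+1}]$. $b_{FM}(\pi)$ is the number of indices $i$ with $s(\pi)\le i\le n$ and $|\pi_{i+1}-\pi_i|\neq1$ (computed with the sorted prefix of the permutation in question). -}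

module Defs where

open import Data.Nat using (ℕ; zero; suc; _+_; _∸_; _≤_; _<_; ∣_-_∣)
open import Data.Nat.Properties using (_≟_; _<?_; _≤?_)
open import Data.Fin using (Fin; toℕ; fromℕ<)
open import Data.Fin.Permutation using (Permutation′; _⟨$⟩ʳ_)
open import Data.List using (List; applyUpTo; map)
open import Data.Nat.ListAction using (sum)
open import Data.Bool using (if_then_else_)
open import Relation.Nullary using (yes; no; does)

-- A sequence  [π₀, π₁, …]  indexed by ℕ; only positions 0..n+1 matter.
Seq : Set
Seq = ℕ → ℕ

-- The extended permutation [0, σ(1), …, σ(n), n+1] of a permutation σ of {1..n},
-- where σ is given as a permutation of Fin n (value k ↦ k+1).
ext : (n : ℕ) → Permutation′ n → Seq
ext n σ zero = 0
ext n σ (suc i) with i <? n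
... | yes p = suc (toℕ (σ ⟨$⟩ʳ fromℕ< p))
... | no _  = suc i

firstBad : Seq → ℕ → ℕ → ℕ
firstBad f k zero = k
firstBad f k (suc fuel) = if does (f k ≟ k) then firstBad f (suc k) fuel else k

-- s(π): largest s ∈ {0..n+1} with π_k = k for all 0 ≤ k ≤ s
-- (π₀ = 0 always, so this is (first index with π_k ≠ k, or n+2) minus 1).
sOf : ℕ → Seq → ℕ
sOf n f = firstBad f 0 (n + 2) ∸ 1

fmReverse : ℕ → ℕ → Seq → Seq
fmReverse s j f i =
  if does (suc s ≤? i) then (if does (i <? j) then f (s + j ∸ i) else f i) else f i

isBreak : Seq → ℕ → ℕ
isBreak f i = if does (∣ f (suc i) - f i ∣ ≟ 1) then 0 else 1

bFM : ℕ → Seq → ℕ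
bFM n f = sum (map (λ k → isBreak f (sOf n f + k)) (applyUpTo (λ k → k) (suc n ∸ sOf n f)))

-- Reversing the block π_{s+1} … π_{j-1} keeps every adjacency strictly inside the block
-- (in reverse order) and every adjacency from position j on, so of the positions counted
-- by b_FM(π) only s and j-1 can lose a breakpoint.  The reversal does not disturb the
-- sorted prefix π₀ … π_s, so s(π·β) ≥ s(π), and b_FM(π·β) still counts every breakpoint
-- of π·β from position s on: those between s and s(π·β) are adjacencies of sorted entries.
module Submission where

open import Defs
open import Data.Bool using (true; false; if_then_else_)
open import Data.Nat using (ℕ; zero; suc; _+_; _∸_; _≤_; _<_; z≤n; s≤s; z<s; s<s; ∣_-_∣)
open import Data.Nat.Properties
open import Data.Nat.ListAction using (sum)
open import Data.Nat.Tactic.RingSolver using (solve-∀)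
open import Data.Fin using (Fin)
open import Data.Fin.Permutation using (Permutation′; _⟨$⟩ʳ_)
open import Data.List using (applyUpTo; map)
open import Data.Product using (_,_)
open import Data.Sum using (inj₁; inj₂)
open import Function using (_∘_)
open import Relation.Binary.PropositionalEquality
  using (_≡_; _≢_; refl; sym; trans; cong; cong₂; subst; module ≡-Reasoning)
open import Relation.Nullary using (¬_; yes; no; does; contradiction)
open import Relation.Nullary.Decidable using (dec-true; dec-false)

m+n≡o⇒o∸m≡n : ∀ m {n o} → m + n ≡ o → o ∸ m ≡ n
m+n≡o⇒o∸m≡n m {n} refl = m+n∸m≡n m n

∑< : ℕ → (ℕ → ℕ) → ℕ
∑< zero    F = 0
∑< (suc m) F = F 0 + ∑< m (F ∘ suc)

syntax ∑< m (λ k → e) = ∑[ k < m ] e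

sum-map-applyUpTo : ∀ (H g : ℕ → ℕ) m → sum (map H (applyUpTo g m)) ≡ ∑[ k < m ] H (g k)
sum-map-applyUpTo H g zero    = refl
sum-map-applyUpTo H g (suc m) = cong (H (g 0) +_) (sum-map-applyUpTo H (g ∘ suc) m)

∑<-cong : ∀ m {F G : ℕ → ℕ} → (∀ k → k < m → F k ≡ G k) → ∑< m F ≡ ∑< m G
∑<-cong zero    eq = refl
∑<-cong (suc m) eq = cong₂ _+_ (eq 0 z<s) (∑<-cong m (λ k k<m → eq (suc k) (s<s k<m)))

∑<-zero : ∀ m {F : ℕ → ℕ} → (∀ k → k < m → F k ≡ 0) → ∑< m F ≡ 0
∑<-zero zero    eq = refl
∑<-zero (suc m) eq = cong₂ _+_ (eq 0 z<s) (∑<-zero m (λ k k<m → eq (suc k) (s<s k<m)))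

∑<-+ : ∀ m p (F : ℕ → ℕ) → ∑< (m + p) F ≡ ∑< m F + ∑[ k < p ] F (m + k)
∑<-+ zero    p F = refl
∑<-+ (suc m) p F = trans (cong (F 0 +_) (∑<-+ m p (F ∘ suc))) (sym (+-assoc (F 0) _ _))

∑<-suc : ∀ m (F : ℕ → ℕ) → ∑< (suc m) F ≡ ∑< m F + F m
∑<-suc zero    F = +-comm (F 0) 0
∑<-suc (suc m) F = trans (cong (F 0 +_) (∑<-suc m (F ∘ suc))) (sym (+-assoc (F 0) _ _))

∑<-reverse : ∀ m {F G : ℕ → ℕ} → (∀ k d → k + suc d ≡ m → F k ≡ G d) → ∑< m F ≡ ∑< m G
∑<-reverse zero    eq = refl
∑<-reverse (suc m) {F} {G} eq = begin
  F 0 + ∑< m (F ∘ suc)  ≡⟨ cong₂ _+_ (eq 0 m refl) (∑<-reverse m (λ k d e → eq (suc k) d (cong suc e))) ⟩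
  G m + ∑< m G          ≡⟨ +-comm (G m) _ ⟩
  ∑< m G + G m          ≡⟨ ∑<-suc m G ⟨
  ∑< (suc m) G          ∎
  where open ≡-Reasoning

firstBad-fixed-step : ∀ (f : Seq) k fuel → f k ≡ k → firstBad f k (suc fuel) ≡ firstBad f (suc k) fuel
firstBad-fixed-step f k fuel p rewrite dec-true (f k ≟ k) p = refl

firstBad-moved-step : ∀ (f : Seq) k fuel → f k ≢ k → firstBad f k (suc fuel) ≡ k
firstBad-moved-step f k fuel p rewrite dec-false (f k ≟ k) p = refl

firstBad-≤ : ∀ (f : Seq) a fuel → firstBad f a fuel ≤ a + fuel
firstBad-≤ f a zero = m≤m+n a 0
firstBad-≤ f a (suc fuel) with f a ≟ a
... | yes p = begin
  firstBad f a (suc fuel)  ≡⟨ firstBad-fixed-step f a fuel p ⟩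
  firstBad f (suc a) fuel  ≤⟨ firstBad-≤ f (suc a) fuel ⟩
  suc a + fuel             ≡⟨ +-suc a fuel ⟨
  a + suc fuel             ∎
  where open ≤-Reasoning
... | no ¬p = ≤-trans (≤-reflexive (firstBad-moved-step f a fuel ¬p)) (m≤m+n a (suc fuel))

firstBad-fixed : ∀ (f : Seq) a fuel k → a ≤ k → k < firstBad f a fuel → f k ≡ k
firstBad-fixed f a zero k a≤k k< = contradiction k< (≤⇒≯ a≤k)
firstBad-fixed f a (suc fuel) k a≤k k< with f a ≟ a
... | no ¬p = contradiction (subst (k <_) (firstBad-moved-step f a fuel ¬p) k<) (≤⇒≯ a≤k)
... | yes p with m≤n⇒m<n∨m≡n a≤k
...   | inj₂ refl = p
...   | inj₁ a<k = firstBad-fixed f (suc a) fuel k a<k (subst (k <_) (firstBad-fixed-step f a fuel p) k<)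

firstBad-beyond : ∀ (f : Seq) a fuel t → t < a + fuel → (∀ k → a ≤ k → k ≤ t → f k ≡ k) →
                  t < firstBad f a fuel
firstBad-beyond f a zero t t< fixed = subst (t <_) (+-identityʳ a) t<
firstBad-beyond f a (suc fuel) t t< fixed with f a ≟ a
... | yes p = subst (t <_) (sym (firstBad-fixed-step f a fuel p))
  (firstBad-beyond f (suc a) fuel t (subst (t <_) (+-suc a fuel) t<)
    (λ k a<k k≤t → fixed k (<⇒≤ a<k) k≤t))
... | no ¬p = subst (t <_) (sym (firstBad-moved-step f a fuel ¬p))
  (≰⇒> (λ a≤t → ¬p (fixed a ≤-refl a≤t)))

sOf≤1+n : ∀ n (f : Seq) → sOf n f ≤ suc n
sOf≤1+n n f = subst (λ m → sOf n f ≤ m ∸ 1) (+-comm n 2) (∸-monoˡ-≤ 1 (firstBad-≤ f 0 (n + 2)))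

sOf-fixed : ∀ n (f : Seq) → f 0 ≡ 0 → ∀ k → k ≤ sOf n f → f k ≡ k
sOf-fixed n f f0 zero    _   = f0
sOf-fixed n f f0 (suc k) k≤s = firstBad-fixed f 0 (n + 2) (suc k) z≤n (suc≤∸1⇒< _ k≤s)
  where
  suc≤∸1⇒< : ∀ r → suc k ≤ r ∸ 1 → suc k < r
  suc≤∸1⇒< (suc r) le = s≤s le

sOf-maximal : ∀ n (f : Seq) t → t ≤ suc n → (∀ k → k ≤ t → f k ≡ k) → t ≤ sOf n f
sOf-maximal n f t t≤1+n fixed = <⇒≤∸1 (firstBad-beyond f 0 (n + 2) t t<n+2 (λ k _ → fixed k))
  where
  t<n+2 : t < n + 2
  t<n+2 = subst (t <_) (+-comm 2 n) (s≤s t≤1+n)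
  <⇒≤∸1 : ∀ {r} → t < r → t ≤ r ∸ 1
  <⇒≤∸1 (s≤s le) = le

fmReverse-below : ∀ s j (f : Seq) i → i ≤ s → fmReverse s j f i ≡ f i
fmReverse-below s j f i i≤s rewrite dec-false (suc s ≤? i) (≤⇒≯ i≤s) = refl

fmReverse-inside : ∀ s j (f : Seq) i → suc s ≤ i → i < j → fmReverse s j f i ≡ f (s + j ∸ i)
fmReverse-inside s j f i s<i i<j rewrite dec-true (suc s ≤? i) s<i | dec-true (i <? j) i<j = refl

fmReverse-above : ∀ s j (f : Seq) i → j ≤ i → fmReverse s j f i ≡ f i
fmReverse-above s j f i j≤i rewrite dec-false (i <? j) (≤⇒≯ j≤i) with does (suc s ≤? i)
... | true  = refl
... | false = refl

isBreak-adjacent : ∀ (f : Seq) i → ∣ f (suc i) - f i ∣ ≡ 1 → isBreak f i ≡ 0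
isBreak-adjacent f i p rewrite dec-true (∣ f (suc i) - f i ∣ ≟ 1) p = refl

isBreak-apart : ∀ (f : Seq) i → ∣ f (suc i) - f i ∣ ≢ 1 → isBreak f i ≡ 1
isBreak-apart f i p rewrite dec-false (∣ f (suc i) - f i ∣ ≟ 1) p = refl

isBreak≤1 : ∀ (f : Seq) i → isBreak f i ≤ 1
isBreak≤1 f i with ∣ f (suc i) - f i ∣ ≟ 1
... | yes p = subst (_≤ 1) (sym (isBreak-adjacent f i p)) z≤n
... | no ¬p = ≤-reflexive (isBreak-apart f i ¬p)

isBreak-fixed : ∀ (f : Seq) i → f i ≡ i → f (suc i) ≡ suc i → isBreak f i ≡ 0
isBreak-fixed f i p q = isBreak-adjacent f i (trans (cong₂ ∣_-_∣ q p) (∣1+m-m∣≡1 i))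
  where
  ∣1+m-m∣≡1 : ∀ m → ∣ suc m - m ∣ ≡ 1
  ∣1+m-m∣≡1 zero    = refl
  ∣1+m-m∣≡1 (suc m) = ∣1+m-m∣≡1 m

isBreak-cong : ∀ (f g : Seq) i c → ∣ f (suc i) - f i ∣ ≡ ∣ g (suc c) - g c ∣ → isBreak f i ≡ isBreak g c
isBreak-cong f g i c eq = cong (λ x → if does (x ≟ 1) then 0 else 1) eq

isBreak-fmReverse-inside : ∀ s j (f : Seq) i c → suc s ≤ i → suc i < j → i + suc c ≡ s + j →
                           isBreak (fmReverse s j f) i ≡ isBreak f c
isBreak-fmReverse-inside s j f i c s<i i+1<j eq = isBreak-cong (fmReverse s j f) f i c (begin
  ∣ g (suc i) - g i ∣            ≡⟨ cong₂ ∣_-_∣ (fmReverse-inside s j f (suc i) (m≤n⇒m≤1+n s<i) i+1<j)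
                                                (fmReverse-inside s j f i s<i (<⇒≤ i+1<j)) ⟩
  ∣ f (s + j ∸ suc i) - f (s + j ∸ i) ∣
                                 ≡⟨ cong₂ (λ x y → ∣ f x - f y ∣)
                                      (m+n≡o⇒o∸m≡n (suc i) (trans (sym (+-suc i c)) eq))
                                      (m+n≡o⇒o∸m≡n i eq) ⟩
  ∣ f c - f (suc c) ∣            ≡⟨ ∣-∣-comm (f c) (f (suc c)) ⟩
  ∣ f (suc c) - f c ∣            ∎)
  where
  open ≡-Reasoning
  g = fmReverse s j f

isBreak-fmReverse-above : ∀ s j (f : Seq) i → j ≤ i → isBreak (fmReverse s j f) i ≡ isBreak f i
isBreak-fmReverse-above s j f i j≤i = isBreak-cong (fmReverse s j f) f i i
  (cong₂ ∣_-_∣ (fmReverse-above s j f (suc i) (m≤n⇒m≤1+n j≤i)) (fmReverse-above s j f i j≤i))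

breaks : Seq → ℕ → ℕ → ℕ
breaks f a m = ∑[ k < m ] isBreak f (a + k)

bFM≡breaks : ∀ n (f : Seq) → bFM n f ≡ breaks f (sOf n f) (suc n ∸ sOf n f)
bFM≡breaks n f = sum-map-applyUpTo (λ k → isBreak f (sOf n f + k)) (λ k → k) (suc n ∸ sOf n f)

breaks-+ : ∀ (f : Seq) a d m → (∀ k → k < d → isBreak f (a + k) ≡ 0) →
           breaks f a (d + m) ≡ breaks f (a + d) m
breaks-+ f a d m adjacent = begin
  breaks f a (d + m)                                 ≡⟨ ∑<-+ d m (λ k → isBreak f (a + k)) ⟩
  breaks f a d + ∑[ k < m ] isBreak f (a + (d + k))  ≡⟨ cong₂ _+_ (∑<-zero d adjacent) shifted ⟩
  breaks f (a + d) m                                 ∎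
  where
  open ≡-Reasoning
  shifted : ∑[ k < m ] isBreak f (a + (d + k)) ≡ breaks f (a + d) m
  shifted = ∑<-cong m (λ k _ → cong (isBreak f) (sym (+-assoc a d k)))

breaks-from-sorted : ∀ n (f : Seq) t → f 0 ≡ 0 → t ≤ sOf n f → breaks f t (suc n ∸ t) ≡ bFM n f
breaks-from-sorted n f t f0 t≤s
  with d , t+d≡s ← m≤n⇒∃[o]m+o≡n t≤s
  with m , s+m≡1+n ← m≤n⇒∃[o]m+o≡n (sOf≤1+n n f) = begin
  breaks f t (suc n ∸ t)   ≡⟨ cong (breaks f t) (m+n≡o⇒o∸m≡n t t+d+m≡1+n) ⟩
  breaks f t (d + m)       ≡⟨ breaks-+ f t d m adjacent ⟩
  breaks f (t + d) m       ≡⟨ cong (λ a → breaks f a m) t+d≡s ⟩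
  breaks f s m             ≡⟨ cong (breaks f s) (m+n≡o⇒o∸m≡n s s+m≡1+n) ⟨
  breaks f s (suc n ∸ s)   ≡⟨ bFM≡breaks n f ⟨
  bFM n f                  ∎
  where
  open ≡-Reasoning
  s = sOf n f
  t+d+m≡1+n : t + (d + m) ≡ suc n
  t+d+m≡1+n = trans (sym (+-assoc t d m)) (trans (cong (_+ m) t+d≡s) s+m≡1+n)
  fixed : ∀ k → k ≤ t + d → f k ≡ k
  fixed k k≤t+d = sOf-fixed n f f0 k (subst (k ≤_) t+d≡s k≤t+d)
  adjacent : ∀ k → k < d → isBreak f (t + k) ≡ 0
  adjacent k k<d = isBreak-fixed f (t + k) (fixed (t + k) (+-monoʳ-≤ t (<⇒≤ k<d)))
    (fixed (suc (t + k)) (subst (_≤ t + d) (+-suc t k) (+-monoʳ-≤ t k<d)))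

sOf-fmReverse : ∀ n (f : Seq) j → f 0 ≡ 0 → sOf n f ≤ sOf n (fmReverse (sOf n f) j f)
sOf-fmReverse n f j f0 = sOf-maximal n _ (sOf n f) (sOf≤1+n n f)
  (λ k k≤s → trans (fmReverse-below (sOf n f) j f k k≤s) (sOf-fixed n f f0 k k≤s))

isBreak-fmReverse-reflected : ∀ (f : Seq) s k d →
  isBreak (fmReverse s (s + 2 + (k + suc d)) f) (s + suc d) ≡ isBreak f (s + suc k)
isBreak-fmReverse-reflected f s k d =
  isBreak-fmReverse-inside s (s + 2 + (k + suc d)) f (s + suc d) (s + suc k) s<i i+1<j (positions s k d)
  where
  s<i : suc s ≤ s + suc d
  s<i = subst (suc s ≤_) (sym (+-suc s d)) (s≤s (m≤m+n s d))
  i+2+k : ∀ s k d → suc (suc (s + suc d)) + k ≡ s + 2 + (k + suc d)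
  i+2+k = solve-∀
  i+1<j : suc (s + suc d) < s + 2 + (k + suc d)
  i+1<j = subst (suc (suc (s + suc d)) ≤_) (i+2+k s k d) (m≤m+n _ k)
  positions : ∀ s k d → s + suc d + suc (s + suc k) ≡ s + (s + 2 + (k + suc d))
  positions = solve-∀

isBreak-fmReverse-tail : ∀ (f : Seq) s L k →
  isBreak (fmReverse s (s + 2 + L) f) (s + suc (L + suc k)) ≡ isBreak f (s + suc (L + suc k))
isBreak-fmReverse-tail f s L k =
  isBreak-fmReverse-above s (s + 2 + L) f _ (subst (s + 2 + L ≤_) (j+k s L k) (m≤m+n _ k))
  where
  j+k : ∀ s L k → s + 2 + L + k ≡ s + suc (L + suc k)
  j+k = solve-∀

∑<-around : ∀ L R (F : ℕ → ℕ) →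
  ∑< (suc (L + suc R)) F ≡ F 0 + (∑[ k < L ] F (suc k) + (F (suc (L + 0)) + ∑[ k < R ] F (suc (L + suc k))))
∑<-around L R F = cong (F 0 +_) (∑<-+ L (suc R) (F ∘ suc))

breaks-fmReverse : ∀ (f : Seq) s L R →
  breaks f s (suc (L + suc R)) ≤ breaks (fmReverse s (s + 2 + L) f) s (suc (L + suc R)) + 2
breaks-fmReverse f s L R = begin
  breaks f s N                               ≡⟨ ∑<-around L R F ⟩
  F 0 + (A + (F (suc (L + 0)) + B))          ≤⟨ +-mono-≤ (isBreak≤1 f _) (+-monoʳ-≤ A (+-monoˡ-≤ B (isBreak≤1 f _))) ⟩
  1 + (A + (1 + B))                          ≡⟨ rearrange A B ⟩
  A + B + 2                                  ≡⟨ cong₂ (λ x y → x + y + 2) interior tail ⟩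
  A′ + B′ + 2                                ≤⟨ +-monoˡ-≤ 2 (≤-trans (+-monoʳ-≤ A′ (m≤n+m B′ _)) (m≤n+m _ (G 0))) ⟩
  G 0 + (A′ + (G (suc (L + 0)) + B′)) + 2    ≡⟨ cong (_+ 2) (∑<-around L R G) ⟨
  breaks g s N + 2                           ∎
  where
  open ≤-Reasoning
  N = suc (L + suc R)
  g = fmReverse s (s + 2 + L) f
  F G : ℕ → ℕ
  F k = isBreak f (s + k)
  G k = isBreak g (s + k)
  A A′ B B′ : ℕ
  A  = ∑[ k < L ] F (suc k)
  A′ = ∑[ k < L ] G (suc k)
  B  = ∑[ k < R ] F (suc (L + suc k))
  B′ = ∑[ k < R ] G (suc (L + suc k))
  rearrange : ∀ A B → 1 + (A + (1 + B)) ≡ A + B + 2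
  rearrange = solve-∀
  interior : A ≡ A′
  interior = ∑<-reverse L (λ k d k+1+d≡L →
    subst (λ L → isBreak f (s + suc k) ≡ isBreak (fmReverse s (s + 2 + L) f) (s + suc d)) k+1+d≡L
          (sym (isBreak-fmReverse-reflected f s k d)))
  tail : B ≡ B′
  tail = ∑<-cong R (λ k _ → sym (isBreak-fmReverse-tail f s L k))

bFM-fmReverse : ∀ n (f : Seq) → f 0 ≡ 0 → ∀ j → sOf n f + 2 ≤ j → j ≤ suc n →
                bFM n f ≤ bFM n (fmReverse (sOf n f) j f) + 2
bFM-fmReverse n f f0 j s+2≤j j≤1+n
  with L , refl ← m≤n⇒∃[o]m+o≡n s+2≤j
  with R , j+R≡1+n ← m≤n⇒∃[o]m+o≡n j≤1+n = begin
  bFM n f                              ≡⟨ bFM≡breaks n f ⟩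
  breaks f s (suc n ∸ s)               ≡⟨ cong (breaks f s) length ⟩
  breaks f s (suc (L + suc R))         ≤⟨ breaks-fmReverse f s L R ⟩
  breaks g s (suc (L + suc R)) + 2     ≡⟨ cong (λ m → breaks g s m + 2) length ⟨
  breaks g s (suc n ∸ s) + 2           ≡⟨ cong (_+ 2) (breaks-from-sorted n g s g0 (sOf-fmReverse n f _ f0)) ⟩
  bFM n g + 2                          ∎
  where
  open ≤-Reasoning
  s = sOf n f
  g = fmReverse s (s + 2 + L) f
  g0 : g 0 ≡ 0
  g0 = trans (fmReverse-below s (s + 2 + L) f 0 z≤n) f0
  split : ∀ s L R → s + suc (L + suc R) ≡ s + 2 + L + R
  split = solve-∀
  length : suc n ∸ s ≡ suc (L + suc R)
  length = m+n≡o⇒o∸m≡n s (trans (split s L R) j+R≡1+n)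

lemma9 : (n : ℕ) (σ : Permutation′ n) →
    ¬ (∀ (i : Fin n) → σ ⟨$⟩ʳ i ≡ i) →
    (j : ℕ) → sOf n (ext n σ) + 3 ≤ j → j ≤ n + 1 →
    bFM n (ext n σ) ≤ bFM n (fmReverse (sOf n (ext n σ)) j (ext n σ)) + 2
lemma9 n σ _ j s+3≤j j≤n+1 = bFM-fmReverse n (ext n σ) refl j
  (≤-trans (+-monoʳ-≤ (sOf n (ext n σ)) (n≤1+n 2)) s+3≤j)
  (subst (j ≤_) (+-comm n 1) j≤n+1)
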